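{- For every even integer $j\ge0$ and all integers $a_{j+2}\ge a_{j+1}\ge1$ of the same parity, the tree $RT(0^j,a_{j+1},a_{j+2})$ is super edge-graceful.
   Context: For a finite simple graph $G$ with $p$ vertices and $q$ edges, $G$ is super edge-graceful if there is a bijection $f$ from $E(G)$ onto $\{0,\pm1,\ldots,\pm\frac{q-1}{2}\}$ when $q$ is odd, and onto $\{\pm1,\ldots,\pm\frac{q}{2}\}$ when $q$ is even, such that the induced vertex labeling $f^+(v)=\sum_{uv\in E(G)} f(uv)$ is a bijection from $V(G)$ onto $\{0,\pm1,\ldots,\pm\frac{p-1}{2}\}$ when $p$ is odd, and onto $\{\pm1,\ldots,\pm\frac{p}{2}\}$ when $p$ is even. $RT(0^j,a,b)$ denotes the rooted tree with root $v_0$ having $j+2$ children: $j$ of them are leaves, one has exactly $a$ children (all leaves) and one has exactly $b$ children (all leaves). -}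

module Defs where

open import Data.Nat using (ℕ; zero; suc; _+_; _*_; _∸_; _≤_; _%_; _≤ᵇ_)
open import Data.Integer using (ℤ; ∣_∣) renaming (_+_ to _+ℤ_; 0ℤ to 0ℤ)
open import Data.Fin using (Fin; zero; suc; toℕ; _≟_)
open import Data.List using (List; map; foldr)
open import Data.List using () renaming (allFin to allFinL)
open import Data.Product using (_×_; Σ; proj₁; proj₂; _,_)
open import Data.Bool using (if_then_else_)
open import Relation.Nullary using (¬_; yes; no)
open import Relation.Binary.PropositionalEquality using (_≡_; _≢_)
open import Function.Definitions using (Injective)

record Graph : Set where
  field
    p    : ℕ
    q    : ℕ
    ends : Fin q → Fin p × Fin p

-- The label set {0,±1,…,±(n-1)/2} (n odd) or {±1,…,±n/2} (n even).
LabelSet : ℕ → ℤ → Set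
LabelSet n z with n % 2
... | zero  = (z ≢ 0ℤ) × (2 * ∣ z ∣ ≤ n)
... | suc _ = 2 * ∣ z ∣ ≤ n ∸ 1

BijOnto : {m : ℕ} → (Fin m → ℤ) → ℕ → Set
BijOnto {m} f n =
  Injective _≡_ _≡_ f
  × ((x : Fin m) → LabelSet n (f x))
  × ((z : ℤ) → LabelSet n z → Σ (Fin m) λ x → f x ≡ z)

-- contribution f(e) if v is an endpoint of e, 0 otherwise
-- (each endpoint counted; graphs here have no loops)
ifEq : {p : ℕ} → Fin p → Fin p → ℤ → ℤ
ifEq u v z with u ≟ v
... | yes _ = z
... | no  _ = 0ℤ

induced : (G : Graph) → (Fin (Graph.q G) → ℤ) → Fin (Graph.p G) → ℤ
induced G f v =
  foldr _+ℤ_ 0ℤ (map (λ e → ifEq (proj₁ (Graph.ends G e)) v (f e)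
                  +ℤ ifEq (proj₂ (Graph.ends G e)) v (f e))
           (allFinL (Graph.q G)))

SuperEdgeGraceful : Graph → Set
SuperEdgeGraceful G =
  Σ (Fin (Graph.q G) → ℤ) λ f →
    BijOnto f (Graph.q G) × BijOnto (induced G f) (Graph.p G)

-- Vertices Fin (3 + (j + a + b)):
--   0 = root v₀, 1 = child with a leaf-children, 2 = child with b leaf-children,
--   3 .. 2+j         : the j leaf children of the root,
--   3+j .. 2+j+a     : the a leaf children of vertex 1,
--   3+j+a .. 2+j+a+b : the b leaf children of vertex 2.
-- Edge e (e : Fin (2 + (j + a + b))) joins vertex suc e to its parent.
parentOf : (j a n : ℕ) → ℕ → Fin (3 + n)
parentOf j a n k =
  if k ≤ᵇ 2 + j then zero
  else if k ≤ᵇ 2 + j + a then suc zero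
  else suc (suc zero)

RT : (j a b : ℕ) → Graph
RT j a b = record
  { p    = 3 + (j + a + b)
  ; q    = 2 + (j + a + b)
  ; ends = λ e → parentOf j a (j + a + b) (suc (toℕ e)) , suc e
  }

module Submission where

-- Write n = j + a + b, so RT(0^j,a,b) has q = n + 2 edges and p = n + 3
-- vertices, and the parity hypotheses make n = 2h even.  Edge 0 (root to the first inner
-- child) gets 1, edge 1 (root to the second inner child) gets -1, and the leaf edges, in
-- order, get the alternating sequence  -μ(0), +μ(0), -μ(1), +μ(1), ...  with
-- μ(t) = 2 + σ(t) for an involution σ of {0,...,h-1}; together these are exactly the
-- labels {±1,...,±(h+1)}.  Every leaf inherits the label of its edge, and a block of the
-- alternating sequence of even length starting at an even position sums to 0.  Hence
--   * a, b even: with σ = id the root, first and second child get 0, 1, -1;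
--   * a, b odd: with σ the transposition of 0 and K = (j + a - 1)/2 the pair -2, +2
--     straddles the two blocks of leaves, and the three vertices get 0, -1, 1.
-- In both cases the vertex labels are 0 followed by a rearrangement of the edge labels,
-- a bijection onto {0,±1,...,±(h+1)}.

open import Defs
open import Data.Nat using (ℕ; _≤_; _%_)
open import Relation.Binary.PropositionalEquality using (_≡_)

open import Data.Nat using (zero; suc; _+_; _*_; _∸_; _<_; _<ᵇ_; _≤ᵇ_; z≤n; s≤s; NonZero; ⌊_/2⌋)
import Data.Nat.Properties as ℕ
open import Data.Integer using (ℤ; +_; -[1+_]; ∣_∣; 0ℤ; 1ℤ; -1ℤ; _◃_; -_)
  renaming (_+_ to _⊕_)
import Data.Integer.Properties as ℤ
open import Data.Sign using (Sign)
open import Data.Fin using (Fin; zero; suc; toℕ; fromℕ<)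
import Data.Fin.Properties as Fin
open import Data.List using (foldr; map; tabulate)
open import Data.Vec.Functional using (_∷_)
open import Data.Bool using (true; false)
open import Data.Bool.Properties using (T-≡; ¬-not)
open import Data.Product using (Σ; _×_; _,_; proj₁; proj₂)
open import Data.Empty using (⊥-elim)
open import Function using (id)
open import Function.Bundles using (Equivalence)
open import Function.Definitions using (Injective)
open import Relation.Nullary using (yes; no)
open import Relation.Binary.PropositionalEquality
  using (refl; sym; trans; cong; cong₂; subst; _≢_; module ≡-Reasoning)
open ≡-Reasoning

∑ : ℕ → (ℕ → ℤ) → ℤ
∑ zero    h = 0ℤ
∑ (suc n) h = h 0 ⊕ ∑ n (λ i → h (suc i))

∑-cong : ∀ n {h h′ : ℕ → ℤ} → (∀ i → i < n → h i ≡ h′ i) → ∑ n h ≡ ∑ n h′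
∑-cong zero    _  = refl
∑-cong (suc n) eq = cong₂ _⊕_ (eq 0 (s≤s z≤n)) (∑-cong n (λ i i<n → eq (suc i) (s≤s i<n)))

∑-zeros : ∀ n → ∑ n (λ _ → 0ℤ) ≡ 0ℤ
∑-zeros zero    = refl
∑-zeros (suc n) = trans (ℤ.+-identityˡ _) (∑-zeros n)

∑-split : ∀ m n h → ∑ (m + n) h ≡ ∑ m h ⊕ ∑ n (λ i → h (m + i))
∑-split zero    n h = sym (ℤ.+-identityˡ _)
∑-split (suc m) n h =
  trans (cong (h 0 ⊕_) (∑-split m n (λ i → h (suc i)))) (sym (ℤ.+-assoc (h 0) _ _))

foldr-tabulate : ∀ {m} n (h : Fin m → ℤ) (ι : Fin n → Fin m) (φ : ℕ → ℤ) →
                 (∀ i → h (ι i) ≡ φ (toℕ i)) → foldr _⊕_ 0ℤ (map h (tabulate ι)) ≡ ∑ n φ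
foldr-tabulate zero    h ι φ eq = refl
foldr-tabulate (suc n) h ι φ eq =
  cong₂ _⊕_ (eq zero) (foldr-tabulate n h (λ i → ι (suc i)) (λ k → φ (suc k)) (λ i → eq (suc i)))

foldr-tabulate-single : ∀ {m} n (h : Fin m → ℤ) (ι : Fin n → Fin m) (i₀ : Fin n) →
                        (∀ i → i ≢ i₀ → h (ι i) ≡ 0ℤ) →
                        foldr _⊕_ 0ℤ (map h (tabulate ι)) ≡ h (ι i₀)
foldr-tabulate-single (suc n) h ι zero others-vanish =
  trans (cong (h (ι zero) ⊕_) rest-vanishes) (ℤ.+-identityʳ _)
  where
  rest-vanishes : foldr _⊕_ 0ℤ (map h (tabulate (λ i → ι (suc i)))) ≡ 0ℤ
  rest-vanishes = trans (foldr-tabulate n h _ (λ _ → 0ℤ) (λ i → others-vanish (suc i) (λ ())))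
                        (∑-zeros n)
foldr-tabulate-single (suc n) h ι (suc i₀) others-vanish =
  trans (cong (_⊕ foldr _⊕_ 0ℤ (map h (tabulate (λ i → ι (suc i)))))
              (others-vanish zero (λ ())))
        (trans (ℤ.+-identityˡ _)
               (foldr-tabulate-single n h (λ i → ι (suc i)) i₀
                  (λ i i≢i₀ → others-vanish (suc i) (λ e → i≢i₀ (Fin.suc-injective e)))))

-- 2t by recursion, so that double (suc t) unfolds to suc (suc (double t)).
double : ℕ → ℕ
double zero    = zero
double (suc t) = suc (suc (double t))

double≡2* : ∀ t → double t ≡ 2 * t
double≡2* zero    = refl
double≡2* (suc t) = cong suc (trans (cong suc (double≡2* t)) (sym (ℕ.+-suc t (t + 0))))

double-+ : ∀ s t → double s + double t ≡ double (s + t)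
double-+ zero    t = refl
double-+ (suc s) t = cong (λ x → suc (suc x)) (double-+ s t)

double-%2 : ∀ t → double t % 2 ≡ 0
double-%2 zero    = refl
double-%2 (suc t) = double-%2 t

odd-%2 : ∀ t → suc (double t) % 2 ≡ 1
odd-%2 zero    = refl
odd-%2 (suc t) = odd-%2 t

data Parity : ℕ → Set where
  even : ∀ t → Parity (double t)
  odd  : ∀ t → Parity (suc (double t))

parity : ∀ n → Parity n
parity zero          = even 0
parity (suc zero)    = odd 0
parity (suc (suc n)) with parity n
... | even t = even (suc t)
... | odd  t = odd (suc t)

labelSet-even : ∀ {n} z → n % 2 ≡ 0 → LabelSet n z ≡ ((z ≢ 0ℤ) × (2 * ∣ z ∣ ≤ n))
labelSet-even {n} z n-even with n % 2 | n-even
... | zero | _ = refl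

labelSet-odd : ∀ {n} z → n % 2 ≡ 1 → LabelSet n z ≡ (2 * ∣ z ∣ ≤ n ∸ 1)
labelSet-odd {n} z n-odd with n % 2 | n-odd
... | suc zero | _ = refl

2*≤double : ∀ {x m} → x ≤ m → 2 * x ≤ double m
2*≤double {x} {m} x≤m = subst (2 * x ≤_) (sym (double≡2* m)) (ℕ.*-monoʳ-≤ 2 x≤m)

2*≤double⁻¹ : ∀ {x m} → 2 * x ≤ double m → x ≤ m
2*≤double⁻¹ {x} {m} le = ℕ.*-cancelˡ-≤ 2 (subst (2 * x ≤_) (double≡2* m) le)

evenLabel-intro : ∀ m {z} → z ≢ 0ℤ → ∣ z ∣ ≤ m → LabelSet (double m) z
evenLabel-intro m {z} z≢0 ∣z∣≤m =
  subst id (sym (labelSet-even z (double-%2 m))) (z≢0 , 2*≤double ∣z∣≤m)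

evenLabel-elim : ∀ m {z} → LabelSet (double m) z → (z ≢ 0ℤ) × (∣ z ∣ ≤ m)
evenLabel-elim m {z} lz with subst id (labelSet-even z (double-%2 m)) lz
... | z≢0 , le = z≢0 , 2*≤double⁻¹ le

oddLabel-intro : ∀ m {z} → ∣ z ∣ ≤ m → LabelSet (suc (double m)) z
oddLabel-intro m {z} ∣z∣≤m = subst id (sym (labelSet-odd z (odd-%2 m))) (2*≤double ∣z∣≤m)

oddLabel-elim : ∀ m {z} → LabelSet (suc (double m)) z → ∣ z ∣ ≤ m
oddLabel-elim m {z} lz = 2*≤double⁻¹ (subst id (labelSet-odd z (odd-%2 m)) lz)

BijOnto-reindex : ∀ {m n} {f g : Fin m → ℤ} (τ : Fin m → Fin m) → (∀ x → τ (τ x) ≡ x) →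
                  (∀ x → g x ≡ f (τ x)) → BijOnto f n → BijOnto g n
BijOnto-reindex {n = n} {f} {g} τ τ-involutive g≗f∘τ (f-inj , f-range , f-onto) =
  g-inj , g-range , g-onto
  where
  g-inj : Injective _≡_ _≡_ g
  g-inj {x} {y} gx≡gy = begin
    x         ≡⟨ sym (τ-involutive x) ⟩
    τ (τ x)   ≡⟨ cong τ (f-inj (trans (sym (g≗f∘τ x)) (trans gx≡gy (g≗f∘τ y)))) ⟩
    τ (τ y)   ≡⟨ τ-involutive y ⟩
    y         ∎
  g-range : ∀ x → LabelSet n (g x)
  g-range x = subst (LabelSet n) (sym (g≗f∘τ x)) (f-range (τ x))
  g-onto : ∀ z → LabelSet n z → Σ _ λ x → g x ≡ z
  g-onto z lz with f-onto z lz
  ... | x , fx≡z = τ x , trans (g≗f∘τ (τ x)) (trans (cong f (τ-involutive x)) fx≡z)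

BijOnto-prepend0 : ∀ {k} m {f : Fin k → ℤ} → BijOnto f (double m) →
                   BijOnto (0ℤ ∷ f) (suc (double m))
BijOnto-prepend0 {k} m {f} (f-inj , f-range , f-onto) = inj , range , onto
  where
  f-nonzero : ∀ x → f x ≢ 0ℤ
  f-nonzero x = proj₁ (evenLabel-elim m (f-range x))
  inj : Injective _≡_ _≡_ (0ℤ ∷ f)
  inj {zero}  {zero}  _ = refl
  inj {zero}  {suc y} e = ⊥-elim (f-nonzero y (sym e))
  inj {suc x} {zero}  e = ⊥-elim (f-nonzero x e)
  inj {suc x} {suc y} e = cong suc (f-inj e)
  range : ∀ x → LabelSet (suc (double m)) ((0ℤ ∷ f) x)
  range zero    = oddLabel-intro m z≤n
  range (suc x) = oddLabel-intro m (proj₂ (evenLabel-elim m (f-range x)))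
  onto : ∀ z → LabelSet (suc (double m)) z → Σ (Fin (suc k)) λ x → (0ℤ ∷ f) x ≡ z
  onto z lz with z ℤ.≟ 0ℤ
  ... | yes z≡0 = zero , sym z≡0
  ... | no  z≢0 with f-onto z (evenLabel-intro m z≢0 (oddLabel-elim m lz))
  ...   | x , fx≡z = suc x , fx≡z

positionSign : ℕ → Sign
positionSign zero          = Sign.-
positionSign (suc zero)    = Sign.+
positionSign (suc (suc k)) = positionSign k

alternating : (ℕ → ℕ) → ℕ → ℤ
alternating μ k = positionSign k ◃ μ ⌊ k /2⌋

cancel-pair : ∀ m z → (Sign.- ◃ m) ⊕ ((Sign.+ ◃ m) ⊕ z) ≡ z
cancel-pair m z = begin
  (Sign.- ◃ m) ⊕ ((Sign.+ ◃ m) ⊕ z)  ≡⟨ sym (ℤ.+-assoc (Sign.- ◃ m) _ z) ⟩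
  ((Sign.- ◃ m) ⊕ (Sign.+ ◃ m)) ⊕ z  ≡⟨ cong (_⊕ z) (cong₂ _⊕_ (ℤ.-◃n≡-n m) (ℤ.+◃n≡+n m)) ⟩
  (- (+ m) ⊕ + m) ⊕ z                ≡⟨ cong (_⊕ z) (ℤ.+-inverseˡ (+ m)) ⟩
  0ℤ ⊕ z                             ≡⟨ ℤ.+-identityˡ z ⟩
  z                                  ∎

-- Dropping the first pair of an alternating sequence shifts its magnitudes by one; this
-- holds by definition, alternating μ (2 + k) = alternating (μ ∘ suc) k.
alternating-evenPrefix : ∀ μ r → ∑ (double r) (alternating μ) ≡ 0ℤ
alternating-evenPrefix μ zero    = refl
alternating-evenPrefix μ (suc r) =
  trans (cancel-pair (μ 0) _) (alternating-evenPrefix (λ t → μ (suc t)) r)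

alternating-oddPrefix : ∀ μ r → ∑ (suc (double r)) (alternating μ) ≡ Sign.- ◃ μ r
alternating-oddPrefix μ zero    = ℤ.+-identityʳ _
alternating-oddPrefix μ (suc r) =
  trans (cancel-pair (μ 0) _) (alternating-oddPrefix (λ t → μ (suc t)) r)

alternating-oddFrom1 : ∀ μ r → ∑ (suc (double r)) (λ i → alternating μ (suc i)) ≡ Sign.+ ◃ μ 0
alternating-oddFrom1 μ r =
  trans (cong ((Sign.+ ◃ μ 0) ⊕_) (alternating-evenPrefix (λ t → μ (suc t)) r)) (ℤ.+-identityʳ _)

alternating-shift : ∀ μ t i → alternating μ (double t + i) ≡ alternating (λ u → μ (t + u)) i
alternating-shift μ zero    i = refl
alternating-shift μ (suc t) i = alternating-shift (λ u → μ (suc u)) t i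

∑-alternating-shift : ∀ μ t n →
  ∑ n (λ i → alternating μ (double t + i)) ≡ ∑ n (alternating (λ u → μ (t + u)))
∑-alternating-shift μ t n = ∑-cong n (λ i _ → alternating-shift μ t i)

signBit : Sign → ℕ
signBit Sign.- = 0
signBit Sign.+ = 1

position-decompose : ∀ k → double ⌊ k /2⌋ + signBit (positionSign k) ≡ k
position-decompose zero          = refl
position-decompose (suc zero)    = refl
position-decompose (suc (suc k)) = cong (λ x → suc (suc x)) (position-decompose k)

alternating-at : ∀ μ t s → alternating μ (double t + signBit s) ≡ s ◃ μ t
alternating-at μ t Sign.- =
  trans (alternating-shift μ t 0) (cong (λ u → Sign.- ◃ μ u) (ℕ.+-identityʳ t))
alternating-at μ t Sign.+ =
  trans (alternating-shift μ t 1) (cong (λ u → Sign.+ ◃ μ u) (ℕ.+-identityʳ t))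

⌊/2⌋-< : ∀ {k h} → k < double h → ⌊ k /2⌋ < h
⌊/2⌋-< {zero}        {suc h} _                 = s≤s z≤n
⌊/2⌋-< {suc zero}    {suc h} _                 = s≤s z≤n
⌊/2⌋-< {suc (suc k)} {suc h} (s≤s (s≤s k<2h)) = s≤s (⌊/2⌋-< k<2h)

position-< : ∀ {t h} s → t < h → double t + signBit s < double h
position-< {zero}  {suc h} Sign.- _           = s≤s z≤n
position-< {zero}  {suc h} Sign.+ _           = s≤s (s≤s z≤n)
position-< {suc t} {suc h} s      (s≤s t<h) = s≤s (s≤s (position-< s t<h))

alternating-injective : ∀ μ → (∀ t → NonZero (μ t)) → (∀ {t u} → μ t ≡ μ u → t ≡ u) →
                        Injective _≡_ _≡_ (alternating μ)
alternating-injective μ μ≢0 μ-inj {k} {k′} eq = begin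
  k                                            ≡⟨ sym (position-decompose k) ⟩
  double ⌊ k /2⌋ + signBit (positionSign k)    ≡⟨ cong₂ (λ t s → double t + signBit s)
                                                        same-pair same-sign ⟩
  double ⌊ k′ /2⌋ + signBit (positionSign k′)  ≡⟨ position-decompose k′ ⟩
  k′                                           ∎
  where
  same-sign : positionSign k ≡ positionSign k′
  same-sign = ℤ.sign-cong {{μ≢0 _}} {{μ≢0 _}} eq
  same-pair : ⌊ k /2⌋ ≡ ⌊ k′ /2⌋
  same-pair = μ-inj (trans (sym (ℤ.abs-◃ _ _)) (trans (cong ∣_∣ eq) (ℤ.abs-◃ _ _)))

record InvolutionBelow (h : ℕ) (σ : ℕ → ℕ) : Set where
  field
    involutive : ∀ t → σ (σ t) ≡ t
    bounded    : ∀ {t} → t < h → σ t < h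

id-involution : ∀ h → InvolutionBelow h id
id-involution h = record { involutive = λ _ → refl ; bounded = id }

transpose0 : ℕ → ℕ → ℕ
transpose0 K zero = K
transpose0 K (suc t) with suc t ℕ.≟ K
... | yes _ = zero
... | no  _ = suc t

transpose0-self : ∀ K → transpose0 K K ≡ 0
transpose0-self zero    = refl
transpose0-self (suc K) with suc K ℕ.≟ suc K
... | yes _     = refl
... | no  K≢K   = ⊥-elim (K≢K refl)

transpose0-involution : ∀ {K h} → K < h → InvolutionBelow h (transpose0 K)
transpose0-involution {K} {h} K<h =
  record { involutive = involutive ; bounded = bounded }
  where
  involutive : ∀ t → transpose0 K (transpose0 K t) ≡ t
  involutive zero = transpose0-self K
  involutive (suc t) with suc t ℕ.≟ K
  ... | yes t+1≡K = sym t+1≡K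
  ... | no  t+1≢K with suc t ℕ.≟ K
  ...   | yes t+1≡K = ⊥-elim (t+1≢K t+1≡K)
  ...   | no  _     = refl
  bounded : ∀ {t} → t < h → transpose0 K t < h
  bounded {zero}  _ = K<h
  bounded {suc t} t<h with suc t ℕ.≟ K
  ... | yes _ = ℕ.≤-trans (s≤s z≤n) t<h
  ... | no  _ = t<h

-- Edges 0 and 1 (from the root to the two inner children) get x and y; the edge of the
-- leaf numbered k (vertex 3 + k) gets g k.
edgeLabel : ∀ {n} → ℤ → ℤ → (ℕ → ℤ) → Fin (2 + n) → ℤ
edgeLabel x y g zero          = x
edgeLabel x y g (suc zero)    = y
edgeLabel x y g (suc (suc i)) = g (toℕ i)

-- The leaf labels: alternating, with magnitudes 2 + σ(t) (±1 are kept for edges 0, 1).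
leafLabel : (ℕ → ℕ) → ℕ → ℤ
leafLabel σ = alternating (λ t → 2 + σ t)

leafLabel-abs : ∀ σ k → ∣ leafLabel σ k ∣ ≡ 2 + σ ⌊ k /2⌋
leafLabel-abs σ k = ℤ.abs-◃ (positionSign k) _

edgeLabel-bijective : ∀ h σ → InvolutionBelow h σ →
                      BijOnto (edgeLabel {double h} 1ℤ -1ℤ (leafLabel σ)) (double (suc h))
edgeLabel-bijective h σ σ-involution = inj , range , onto
  where
  open InvolutionBelow σ-involution
  ℓ : ℕ → ℤ
  ℓ = leafLabel σ

  ℓ-inj : Injective _≡_ _≡_ ℓ
  ℓ-inj = alternating-injective _ (λ _ → _) λ e →
    trans (sym (involutive _))
          (trans (cong σ (ℕ.suc-injective (ℕ.suc-injective e))) (involutive _))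

  ℓ-avoids-small : ∀ k {z} → ∣ z ∣ < 2 → ℓ k ≢ z
  ℓ-avoids-small k ∣z∣<2 refl =
    ℕ.<⇒≱ ∣z∣<2 (subst (2 ≤_) (sym (leafLabel-abs σ k)) (s≤s (s≤s z≤n)))

  ℓ≢±1 : ∀ k {z} → ∣ z ∣ ≡ 1 → ℓ k ≢ z
  ℓ≢±1 k ∣z∣≡1 = ℓ-avoids-small k (subst (_< 2) (sym ∣z∣≡1) (s≤s (s≤s z≤n)))

  inj : Injective _≡_ _≡_ (edgeLabel 1ℤ -1ℤ ℓ)
  inj {zero}          {zero}           _ = refl
  inj {suc zero}      {suc zero}       _ = refl
  inj {suc (suc i)}   {suc (suc i′)}   e =
    cong (λ x → suc (suc x)) (Fin.toℕ-injective (ℓ-inj e))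
  inj {zero}          {suc zero}       ()
  inj {suc zero}      {zero}           ()
  inj {zero}          {suc (suc i)}    e = ⊥-elim (ℓ≢±1 (toℕ i) refl (sym e))
  inj {suc zero}      {suc (suc i)}    e = ⊥-elim (ℓ≢±1 (toℕ i) refl (sym e))
  inj {suc (suc i)}   {zero}           e = ⊥-elim (ℓ≢±1 (toℕ i) refl e)
  inj {suc (suc i)}   {suc zero}       e = ⊥-elim (ℓ≢±1 (toℕ i) refl e)

  range : ∀ e → LabelSet (double (suc h)) (edgeLabel 1ℤ -1ℤ ℓ e)
  range zero          = evenLabel-intro (suc h) (λ ()) (s≤s z≤n)
  range (suc zero)    = evenLabel-intro (suc h) (λ ()) (s≤s z≤n)
  range (suc (suc i)) = evenLabel-intro (suc h) (ℓ-avoids-small (toℕ i) (s≤s z≤n)) ∣ℓ∣≤h+1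
    where
    ∣ℓ∣≤h+1 : ∣ ℓ (toℕ i) ∣ ≤ suc h
    ∣ℓ∣≤h+1 = subst (_≤ suc h) (sym (leafLabel-abs σ (toℕ i)))
                    (s≤s (bounded (⌊/2⌋-< (Fin.toℕ<n i))))

  -- the label s(2 + m), m < h, sits on the leaf at position 2σ(m) or 2σ(m) + 1
  leaf-onto : ∀ s m → m < h → Σ (Fin (2 + double h)) λ e → edgeLabel 1ℤ -1ℤ ℓ e ≡ s ◃ (2 + m)
  leaf-onto s m m<h = suc (suc (fromℕ< k<2h)) , (begin
    ℓ (toℕ (fromℕ< k<2h))           ≡⟨ cong ℓ (Fin.toℕ-fromℕ< k<2h) ⟩
    ℓ (double (σ m) + signBit s)    ≡⟨ alternating-at (λ t → 2 + σ t) (σ m) s ⟩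
    s ◃ (2 + σ (σ m))               ≡⟨ cong (λ t → s ◃ (2 + t)) (involutive m) ⟩
    s ◃ (2 + m)                     ∎)
    where
    k<2h : double (σ m) + signBit s < double h
    k<2h = position-< s (bounded m<h)

  onto : ∀ z → LabelSet (double (suc h)) z →
         Σ (Fin (2 + double h)) λ e → edgeLabel 1ℤ -1ℤ ℓ e ≡ z
  onto (+ zero)          lz = ⊥-elim (proj₁ (evenLabel-elim (suc h) lz) refl)
  onto (+ suc zero)      _  = zero , refl
  onto -[1+ zero ]       _  = suc zero , refl
  onto (+ suc (suc m))   lz = leaf-onto Sign.+ m (ℕ.≤-pred (proj₂ (evenLabel-elim (suc h) lz)))
  onto -[1+ suc m ]      lz = leaf-onto Sign.- m (ℕ.≤-pred (proj₂ (evenLabel-elim (suc h) lz)))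

swap01 : ∀ {n} → Fin (2 + n) → Fin (2 + n)
swap01 zero          = suc zero
swap01 (suc zero)    = zero
swap01 (suc (suc i)) = suc (suc i)

swap01-involutive : ∀ {n} (e : Fin (2 + n)) → swap01 (swap01 e) ≡ e
swap01-involutive zero          = refl
swap01-involutive (suc zero)    = refl
swap01-involutive (suc (suc i)) = refl

edgeLabel±-bijective : ∀ h σ s → InvolutionBelow h σ →
  BijOnto (edgeLabel {double h} (s ◃ 1) (- (s ◃ 1)) (leafLabel σ)) (double (suc h))
edgeLabel±-bijective h σ Sign.+ σ-involution = edgeLabel-bijective h σ σ-involution
edgeLabel±-bijective h σ Sign.- σ-involution =
  BijOnto-reindex swap01 swap01-involutive exchanged (edgeLabel-bijective h σ σ-involution)
  where
  exchanged : ∀ e → edgeLabel -1ℤ 1ℤ (leafLabel σ) e ≡ edgeLabel 1ℤ -1ℤ (leafLabel σ) (swap01 e)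
  exchanged zero          = refl
  exchanged (suc zero)    = refl
  exchanged (suc (suc i)) = refl

vertexLabel : ∀ {n} → Sign → (ℕ → ℤ) → Fin (3 + n) → ℤ
vertexLabel s g = 0ℤ ∷ edgeLabel (s ◃ 1) (- (s ◃ 1)) g

vertexLabel-bijective : ∀ h σ s → InvolutionBelow h σ →
  BijOnto (vertexLabel {double h} s (leafLabel σ)) (3 + double h)
vertexLabel-bijective h σ s σ-involution =
  BijOnto-prepend0 (suc h) (edgeLabel±-bijective h σ s σ-involution)

ifEq-self : ∀ {p} (u : Fin p) z → ifEq u u z ≡ z
ifEq-self u z with u Fin.≟ u
... | yes _   = refl
... | no  u≢u = ⊥-elim (u≢u refl)

ifEq-distinct : ∀ {p} {u v : Fin p} z → u ≢ v → ifEq u v z ≡ 0ℤ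
ifEq-distinct {u = u} {v} z u≢v with u Fin.≟ v
... | yes u≡v = ⊥-elim (u≢v u≡v)
... | no  _   = refl

<ᵇ-true : ∀ {m n} → m < n → (m <ᵇ n) ≡ true
<ᵇ-true m<n = Equivalence.to T-≡ (ℕ.<⇒<ᵇ m<n)

<ᵇ-false : ∀ {m n} → n ≤ m → (m <ᵇ n) ≡ false
<ᵇ-false {m} {n} n≤m = ¬-not λ m<ᵇn → ℕ.<⇒≱ (ℕ.<ᵇ⇒< m n (Equivalence.from T-≡ m<ᵇn)) n≤m

module InducedLabel (j a b : ℕ) (x y : ℤ) (g : ℕ → ℤ) where

  n : ℕ
  n = j + a + b

  f : Fin (2 + n) → ℤ
  f = edgeLabel x y g

  parent : ℕ → Fin (3 + n)
  parent = parentOf j a n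

  incidence : Fin (3 + n) → Fin (2 + n) → ℤ
  incidence v e = ifEq (parent (suc (toℕ e))) v (f e) ⊕ ifEq (suc e) v (f e)

  parent-root : ∀ {k} → k < j → parent (3 + k) ≡ zero
  parent-root k<j rewrite <ᵇ-true k<j = refl

  parent-first : ∀ {k} → j ≤ k → k < j + a → parent (3 + k) ≡ suc zero
  parent-first j≤k k<j+a rewrite <ᵇ-false j≤k | <ᵇ-true k<j+a = refl

  parent-second : ∀ {k} → j + a ≤ k → parent (3 + k) ≡ suc (suc zero)
  parent-second {k} j+a≤k
    rewrite <ᵇ-false (ℕ.≤-trans (ℕ.m≤m+n j a) j+a≤k) | <ᵇ-false j+a≤k = refl

  parent-notLeaf : ∀ k (i : Fin n) → parent k ≢ suc (suc (suc i))
  parent-notLeaf k i with k ≤ᵇ 2 + j | k ≤ᵇ 2 + j + a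
  ... | true  | _     = λ ()
  ... | false | true  = λ ()
  ... | false | false = λ ()

  -- At a vertex v other than a leaf, edges 0 and 1 contribute directly and the leaf edges
  -- fall into three blocks with a fixed parent each.
  induced-internal : ∀ v → (∀ i → suc (suc (suc i)) ≢ v) →
    induced (RT j a b) f v ≡
      incidence v zero ⊕ (incidence v (suc zero) ⊕
        ((∑ j (λ k → ifEq zero v (g k)) ⊕ ∑ a (λ k → ifEq (suc zero) v (g (j + k))))
           ⊕ ∑ b (λ k → ifEq (suc (suc zero)) v (g (j + a + k)))))
  induced-internal v not-leaf =
    cong (λ s → incidence v zero ⊕ (incidence v (suc zero) ⊕ s)) (begin
      foldr _⊕_ 0ℤ (map (incidence v) (tabulate (λ i → suc (suc i))))
        ≡⟨ foldr-tabulate n (incidence v) _ φ leaf-edge ⟩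
      ∑ (j + a + b) φ
        ≡⟨ ∑-split (j + a) b φ ⟩
      ∑ (j + a) φ ⊕ ∑ b (λ k → φ (j + a + k))
        ≡⟨ cong (_⊕ ∑ b (λ k → φ (j + a + k))) (∑-split j a φ) ⟩
      (∑ j φ ⊕ ∑ a (λ k → φ (j + k))) ⊕ ∑ b (λ k → φ (j + a + k))
        ≡⟨ cong₂ _⊕_ (cong₂ _⊕_ (∑-cong j root-block) (∑-cong a first-block))
                     (∑-cong b second-block) ⟩
      (∑ j (λ k → ifEq zero v (g k)) ⊕ ∑ a (λ k → ifEq (suc zero) v (g (j + k))))
        ⊕ ∑ b (λ k → ifEq (suc (suc zero)) v (g (j + a + k)))
        ∎)
    where
    φ : ℕ → ℤ
    φ k = ifEq (parent (3 + k)) v (g k)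
    leaf-edge : ∀ i → incidence v (suc (suc i)) ≡ φ (toℕ i)
    leaf-edge i = trans (cong (φ (toℕ i) ⊕_) (ifEq-distinct _ (not-leaf i))) (ℤ.+-identityʳ _)
    root-block : ∀ k → k < j → φ k ≡ ifEq zero v (g k)
    root-block k k<j = cong (λ u → ifEq u v (g k)) (parent-root k<j)
    first-block : ∀ k → k < a → φ (j + k) ≡ ifEq (suc zero) v (g (j + k))
    first-block k k<a =
      cong (λ u → ifEq u v (g (j + k))) (parent-first (ℕ.m≤m+n j k) (ℕ.+-monoʳ-< j k<a))
    second-block : ∀ k → k < b → φ (j + a + k) ≡ ifEq (suc (suc zero)) v (g (j + a + k))
    second-block k _ = cong (λ u → ifEq u v (g (j + a + k))) (parent-second (ℕ.m≤m+n (j + a) k))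

  induced-root : induced (RT j a b) f zero ≡ x ⊕ (y ⊕ ∑ j g)
  induced-root = begin
    induced (RT j a b) f zero
      ≡⟨ induced-internal zero (λ _ ()) ⟩
    (x ⊕ 0ℤ) ⊕ ((y ⊕ 0ℤ) ⊕ ((∑ j g ⊕ ∑ a (λ _ → 0ℤ)) ⊕ ∑ b (λ _ → 0ℤ)))
      ≡⟨ cong₂ (λ u w → (x ⊕ 0ℤ) ⊕ ((y ⊕ 0ℤ) ⊕ ((∑ j g ⊕ u) ⊕ w))) (∑-zeros a) (∑-zeros b) ⟩
    (x ⊕ 0ℤ) ⊕ ((y ⊕ 0ℤ) ⊕ ((∑ j g ⊕ 0ℤ) ⊕ 0ℤ))
      ≡⟨ cong₂ _⊕_ (ℤ.+-identityʳ x)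
           (cong₂ _⊕_ (ℤ.+-identityʳ y) (trans (ℤ.+-identityʳ _) (ℤ.+-identityʳ _))) ⟩
    x ⊕ (y ⊕ ∑ j g)
      ∎

  induced-first : induced (RT j a b) f (suc zero) ≡ x ⊕ ∑ a (λ k → g (j + k))
  induced-first = begin
    induced (RT j a b) f (suc zero)
      ≡⟨ induced-internal (suc zero) (λ _ ()) ⟩
    (0ℤ ⊕ x) ⊕ (0ℤ ⊕ ((∑ j (λ _ → 0ℤ) ⊕ A) ⊕ ∑ b (λ _ → 0ℤ)))
      ≡⟨ cong₂ (λ u w → (0ℤ ⊕ x) ⊕ (0ℤ ⊕ ((u ⊕ A) ⊕ w))) (∑-zeros j) (∑-zeros b) ⟩
    (0ℤ ⊕ x) ⊕ (0ℤ ⊕ ((0ℤ ⊕ A) ⊕ 0ℤ))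
      ≡⟨ cong₂ _⊕_ (ℤ.+-identityˡ x)
           (trans (ℤ.+-identityˡ _) (trans (ℤ.+-identityʳ _) (ℤ.+-identityˡ A))) ⟩
    x ⊕ A
      ∎
    where
    A : ℤ
    A = ∑ a (λ k → g (j + k))

  induced-second : induced (RT j a b) f (suc (suc zero)) ≡ y ⊕ ∑ b (λ k → g (j + a + k))
  induced-second = begin
    induced (RT j a b) f (suc (suc zero))
      ≡⟨ induced-internal (suc (suc zero)) (λ _ ()) ⟩
    (0ℤ ⊕ 0ℤ) ⊕ ((0ℤ ⊕ y) ⊕ ((∑ j (λ _ → 0ℤ) ⊕ ∑ a (λ _ → 0ℤ)) ⊕ B))
      ≡⟨ cong₂ (λ u w → (0ℤ ⊕ 0ℤ) ⊕ ((0ℤ ⊕ y) ⊕ ((u ⊕ w) ⊕ B))) (∑-zeros j) (∑-zeros a) ⟩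
    0ℤ ⊕ ((0ℤ ⊕ y) ⊕ (0ℤ ⊕ B))
      ≡⟨ trans (ℤ.+-identityˡ _) (cong₂ _⊕_ (ℤ.+-identityˡ y) (ℤ.+-identityˡ B)) ⟩
    y ⊕ B
      ∎
    where
    B : ℤ
    B = ∑ b (λ k → g (j + a + k))

  induced-leaf : ∀ i → induced (RT j a b) f (suc (suc (suc i))) ≡ g (toℕ i)
  induced-leaf i = begin
    induced (RT j a b) f v
      ≡⟨ foldr-tabulate-single (2 + n) (incidence v) id (suc (suc i)) other-edge ⟩
    incidence v (suc (suc i))
      ≡⟨ cong₂ _⊕_ (ifEq-distinct _ (parent-notLeaf (3 + toℕ i) i)) (ifEq-self v _) ⟩
    0ℤ ⊕ g (toℕ i)
      ≡⟨ ℤ.+-identityˡ _ ⟩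
    g (toℕ i)
      ∎
    where
    v : Fin (3 + n)
    v = suc (suc (suc i))
    other-edge : ∀ e → e ≢ suc (suc i) → incidence v e ≡ 0ℤ
    other-edge e e≢ = cong₂ _⊕_ (ifEq-distinct _ (parent-notLeaf (suc (toℕ e)) i))
                                (ifEq-distinct _ (λ e+1≡v → e≢ (Fin.suc-injective e+1≡v)))

RT-graceful : ∀ j a b h σ s → InvolutionBelow h σ → j + a + b ≡ double h →
  ∑ j (leafLabel σ) ≡ 0ℤ →
  1ℤ ⊕ ∑ a (λ k → leafLabel σ (j + k)) ≡ s ◃ 1 →
  -1ℤ ⊕ ∑ b (λ k → leafLabel σ (j + a + k)) ≡ - (s ◃ 1) →
  SuperEdgeGraceful (RT j a b)
RT-graceful j a b h σ s σ-involution n≡2h root-sum first-label second-label =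
  f , edges-bijective , vertices-bijective
  where
  open InducedLabel j a b 1ℤ -1ℤ (leafLabel σ)

  edges-bijective : BijOnto f (2 + n)
  edges-bijective = subst (λ m → BijOnto (edgeLabel {m} 1ℤ -1ℤ (leafLabel σ)) (2 + m))
                          (sym n≡2h) (edgeLabel-bijective h σ σ-involution)

  induced≗vertexLabel : ∀ v → induced (RT j a b) f v ≡ vertexLabel s (leafLabel σ) v
  induced≗vertexLabel zero                =
    trans induced-root (cong (λ t → 1ℤ ⊕ (-1ℤ ⊕ t)) root-sum)
  induced≗vertexLabel (suc zero)          = trans induced-first first-label
  induced≗vertexLabel (suc (suc zero))    = trans induced-second second-label
  induced≗vertexLabel (suc (suc (suc i))) = induced-leaf i

  vertices-bijective : BijOnto (induced (RT j a b) f) (3 + n)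
  vertices-bijective =
    BijOnto-reindex id (λ _ → refl) induced≗vertexLabel
      (subst (λ m → BijOnto (vertexLabel {m} s (leafLabel σ)) (3 + m))
             (sym n≡2h) (vertexLabel-bijective h σ s σ-involution))

-- a, b even: take σ = id.  All three blocks of leaves have even length and start at even
-- positions, so they sum to 0 and the inner children get 1 and -1.
RT-graceful-even : ∀ tj ta tb → SuperEdgeGraceful (RT (double tj) (double ta) (double tb))
RT-graceful-even tj ta tb =
  RT-graceful (double tj) (double ta) (double tb) (tj + ta + tb) id Sign.+
    (id-involution _) size (alternating-evenPrefix μ tj)
    (cong (1ℤ ⊕_) first-block) (cong (-1ℤ ⊕_) second-block)
  where
  μ : ℕ → ℕ
  μ t = 2 + t
  size : double tj + double ta + double tb ≡ double (tj + ta + tb)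
  size = trans (cong (_+ double tb) (double-+ tj ta)) (double-+ (tj + ta) tb)
  first-block : ∑ (double ta) (λ k → alternating μ (double tj + k)) ≡ 0ℤ
  first-block = trans (∑-alternating-shift μ tj (double ta))
                      (alternating-evenPrefix (λ u → μ (tj + u)) ta)
  second-block : ∑ (double tb) (λ k → alternating μ (double tj + double ta + k)) ≡ 0ℤ
  second-block = begin
    ∑ (double tb) (λ k → alternating μ (double tj + double ta + k))
      ≡⟨ cong (λ o → ∑ (double tb) (λ k → alternating μ (o + k))) (double-+ tj ta) ⟩
    ∑ (double tb) (λ k → alternating μ (double (tj + ta) + k))
      ≡⟨ ∑-alternating-shift μ (tj + ta) (double tb) ⟩
    ∑ (double tb) (alternating (λ u → μ (tj + ta + u)))
      ≡⟨ alternating-evenPrefix (λ u → μ (tj + ta + u)) tb ⟩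
    0ℤ
      ∎

-- a, b odd: take σ the transposition of 0 and K = tj + ta.  The pair -2, +2 then sits at
-- positions 2K, 2K + 1: the last leaf of the first inner child and the first leaf of the
-- second, which therefore get 1 - 2 = -1 and -1 + 2 = 1.
RT-graceful-odd : ∀ tj ta tb →
  SuperEdgeGraceful (RT (double tj) (suc (double ta)) (suc (double tb)))
RT-graceful-odd tj ta tb =
  RT-graceful (double tj) (suc (double ta)) (suc (double tb)) (suc (K + tb)) σ Sign.-
    (transpose0-involution (s≤s (ℕ.m≤m+n K tb))) size (alternating-evenPrefix μ tj)
    (cong (1ℤ ⊕_) first-block) (cong (-1ℤ ⊕_) second-block)
  where
  K : ℕ
  K = tj + ta
  σ : ℕ → ℕ
  σ = transpose0 K
  μ : ℕ → ℕ
  μ t = 2 + σ t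
  j+a≡2K+1 : double tj + suc (double ta) ≡ suc (double K)
  j+a≡2K+1 = trans (ℕ.+-suc (double tj) (double ta)) (cong suc (double-+ tj ta))
  size : double tj + suc (double ta) + suc (double tb) ≡ double (suc (K + tb))
  size = begin
    double tj + suc (double ta) + suc (double tb) ≡⟨ cong (_+ suc (double tb)) j+a≡2K+1 ⟩
    suc (double K + suc (double tb))             ≡⟨ cong suc (ℕ.+-suc (double K) (double tb)) ⟩
    suc (suc (double K + double tb))             ≡⟨ cong (λ m → suc (suc m)) (double-+ K tb) ⟩
    double (suc (K + tb))                        ∎
  first-block : ∑ (suc (double ta)) (λ k → alternating μ (double tj + k)) ≡ Sign.- ◃ 2
  first-block = begin
    ∑ (suc (double ta)) (λ k → alternating μ (double tj + k))
      ≡⟨ ∑-alternating-shift μ tj (suc (double ta)) ⟩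
    ∑ (suc (double ta)) (alternating (λ u → μ (tj + u)))
      ≡⟨ alternating-oddPrefix (λ u → μ (tj + u)) ta ⟩
    Sign.- ◃ (2 + σ K)
      ≡⟨ cong (λ t → Sign.- ◃ (2 + t)) (transpose0-self K) ⟩
    Sign.- ◃ 2
      ∎
  second-block :
    ∑ (suc (double tb)) (λ k → alternating μ (double tj + suc (double ta) + k)) ≡ Sign.+ ◃ 2
  second-block = begin
    ∑ (suc (double tb)) (λ k → alternating μ (double tj + suc (double ta) + k))
      ≡⟨ cong (λ o → ∑ (suc (double tb)) (λ k → alternating μ (o + k))) j+a≡2K+1 ⟩
    ∑ (suc (double tb)) (λ k → alternating μ (suc (double K + k)))
      ≡⟨ ∑-cong (suc (double tb)) (λ k _ → cong (alternating μ) (sym (ℕ.+-suc (double K) k))) ⟩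
    ∑ (suc (double tb)) (λ k → alternating μ (double K + suc k))
      ≡⟨ ∑-cong (suc (double tb)) (λ k _ → alternating-shift μ K (suc k)) ⟩
    ∑ (suc (double tb)) (λ k → alternating (λ u → μ (K + u)) (suc k))
      ≡⟨ alternating-oddFrom1 (λ u → μ (K + u)) tb ⟩
    Sign.+ ◃ (2 + σ (K + 0))
      ≡⟨ cong (λ t → Sign.+ ◃ (2 + σ t)) (ℕ.+-identityʳ K) ⟩
    Sign.+ ◃ (2 + σ K)
      ≡⟨ cong (λ t → Sign.+ ◃ (2 + t)) (transpose0-self K) ⟩
    Sign.+ ◃ 2
      ∎

-- The theorem: j is even and a, b have the same parity, so one of the two cases applies.
-- (The hypotheses 1 ≤ a ≤ b only normalise the shape of the tree; the labelling does not
-- need them.)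
lemma1 : (j a b : ℕ) → j % 2 ≡ 0 → 1 ≤ a → a ≤ b → a % 2 ≡ b % 2
       → SuperEdgeGraceful (RT j a b)
lemma1 j a b j-even _ _ same-parity with parity j | parity a | parity b
... | odd tj  | _       | _       = ⊥-elim (ℕ.1+n≢0 (trans (sym (odd-%2 tj)) j-even))
... | even tj | even ta | even tb = RT-graceful-even tj ta tb
... | even tj | odd ta  | odd tb  = RT-graceful-odd tj ta tb
... | even _  | even ta | odd tb  =
  ⊥-elim (ℕ.0≢1+n (trans (sym (double-%2 ta)) (trans same-parity (odd-%2 tb))))
... | even _  | odd ta  | even tb =
  ⊥-elim (ℕ.1+n≢0 (trans (sym (odd-%2 ta)) (trans same-parity (double-%2 tb))))
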